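{- For every $n\ge2$, the graph $H_n$ is both a global amoeba and a local amoeba, has minimum degree $\delta(H_n)=1$, has $e(H_n)=\lfloor n^2/4\rfloor$ edges, and has clique number $\omega(H_n)=\lfloor n/2\rfloor+1$.
   Context: For $n\ge2$, let $q=\lfloor n/2\rfloor$. The graph $H_n$ has vertex set $A\cup B$ with $A=\{v_1,\dots,v_q\}$ and $B=\{v_{q+1},\dots,v_{q+\lceil n/2\rceil}\}$, where $B$ is a clique, $A$ is an independent set, and for $1\le i\le q$, $1\le j\le\lceil n/2\rceil$, $v_iv_{q+j}\in E(H_n)$ if and only if $j\le i$. For a graph $G$ on vertex set $V=\{v_1,\dots,v_n\}$ let $L_G=\{ij: v_iv_j\in E(G)\}$; for $\sigma\in S_n$, $G_\sigma$ is the graph on $V$ with $E(G_\sigma)=\{v_{\sigma^{ -1}(i)}v_{\sigma^{ -1}(j)}: ij\in L_G\}$. An edge-replacement $e\to e'$ ($e\in E(G)$, $e'\in E(\overline G)\cup\{e\}$) is feasible if $G-e+e'\cong G$. Let $R_G$ be the set of feasible replacements $rs\to kl$, $S_G(rs\to kl)=\{\sigma\in S_n: G_\sigma=G-v_rv_s+v_kv_l\}$, and $S_G\le S_n$ the group generated by $\bigcup_{rs\to kl\in R_G}S_G(rs\to kl)$. $G$ is a local amoeba if $S_G=S_n$; $G$ is a global amoeba if there is $T\ge0$ such that $G\cup tK_1$ ($G$ plus $t$ isolated vertices) is a local amoeba for all $t\ge T$. -}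

module Defs where

open import Data.Nat using (ℕ; zero; suc; _+_; _*_; _∸_; _≤_; _<_; _/_)
open import Data.Nat.Properties using (_<?_; _≤?_)
import Data.Nat.Properties as ℕP
open import Data.Fin using (Fin; toℕ; splitAt)
open import Data.Fin.Properties using (_≟_)
open import Data.Fin.Permutation using (Permutation′; _⟨$⟩ʳ_; _≈_; id; flip; _∘ₚ_)
open import Data.Fin.Subset using (Subset; _∈_; ∣_∣)
open import Data.List using (List; map; allFin)
open import Data.Nat.ListAction using (sum)
open import Data.Bool using (Bool; true; false; if_then_else_; _∧_; _∨_; not)
open import Data.Sum using (inj₁; inj₂)
open import Data.Product using (Σ; ∃; _×_; _,_)
open import Relation.Nullary using (¬_; does)
open import Relation.Binary.PropositionalEquality using (_≡_; _≢_)

-- Graphs on the vertex set V = {v_1,...,v_n}, encoded as Fin n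
-- (vertex v_{i+1} is the element i of Fin n).  A graph is given by its
-- Boolean adjacency function; edges are unordered pairs {x,y}, x ≠ y,
-- with adj x y ≡ true.

Graph : ℕ → Set
Graph n = Fin n → Fin n → Bool

_==_ : ∀ {n} → Fin n → Fin n → Bool
x == y = does (x ≟ y)

samePair : ∀ {n} → Fin n → Fin n → Fin n → Fin n → Bool
samePair x y k l = ((x == k) ∧ (y == l)) ∨ ((x == l) ∧ (y == k))

-- The graph H_n.  q = ⌊n/2⌋, A = {v_1..v_q} (indices 0..q-1),
-- B = {v_{q+1}..v_n} (indices q..n-1).  For a = v_i (i = a+1) and
-- b = v_{q+j} (j = b-q+1): adjacent iff j ≤ i, i.e. b ≤ a + q.

adjℕ : ℕ → ℕ → ℕ → Bool
adjℕ q a b with does (a <? q) | does (b <? q)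
... | true  | true  = false
... | false | false = not (does (a ℕP.≟ b))
... | true  | false = does (b ≤? a + q)
... | false | true  = does (a ≤? b + q)

H : (n : ℕ) → Graph n
H n x y = adjℕ (n / 2) (toℕ x) (toℕ y)

count : List Bool → ℕ
count bs = sum (map (λ b → if b then 1 else 0) bs)

degree : ∀ {n} → Graph n → Fin n → ℕ
degree {n} G x = count (map (λ y → G x y) (allFin n))

edgeCount : ∀ {n} → Graph n → ℕ
edgeCount {n} G =
  sum (map (λ x → count (map (λ y → does (toℕ x <? toℕ y) ∧ G x y) (allFin n))) (allFin n))

MinDegree : ∀ {n} → Graph n → ℕ → Set
MinDegree {n} G m = (∀ x → m ≤ degree G x) × (∃ λ x → degree G x ≡ m)

IsClique : ∀ {n} → Graph n → Subset n → Set
IsClique G S = ∀ x y → x ∈ S → y ∈ S → x ≢ y → G x y ≡ true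

CliqueNumber : ∀ {n} → Graph n → ℕ → Set
CliqueNumber {n} G m =
  (∃ λ S → IsClique G S × ∣ S ∣ ≡ m) × (∀ S → IsClique G S → ∣ S ∣ ≤ m)

infix 10 _[_]
infix 4 _≐_ _≅_

-- G_σ : x ~ y iff σ(x) ~ σ(y) in G  (edges v_{σ⁻¹(i)} v_{σ⁻¹(j)}, ij ∈ L_G)
_[_] : ∀ {n} → Graph n → Permutation′ n → Graph n
(G [ σ ]) x y = G (σ ⟨$⟩ʳ x) (σ ⟨$⟩ʳ y)

replace : ∀ {n} → Graph n → (r s k l : Fin n) → Graph n
replace G r s k l x y = samePair x y k l ∨ (G x y ∧ not (samePair x y r s))

_≐_ : ∀ {n} → Graph n → Graph n → Set
G ≐ G' = ∀ x y → G x y ≡ G' x y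

_≅_ : ∀ {n} → Graph n → Graph n → Set
G ≅ G' = ∃ λ (σ : Permutation′ _) → G [ σ ] ≐ G'

Feasible : ∀ {n} → Graph n → (r s k l : Fin n) → Set
Feasible G r s k l =
  r ≢ s × G r s ≡ true
  × ((k ≢ l × G k l ≡ false) Data.Sum.⊎ samePair k l r s ≡ true)
  × (replace G r s k l ≅ G)

InS : ∀ {n} → Graph n → (r s k l : Fin n) → Permutation′ n → Set
InS G r s k l σ = G [ σ ] ≐ replace G r s k l

Generator : ∀ {n} → Graph n → Permutation′ n → Set
Generator G σ = ∃ λ r → ∃ λ s → ∃ λ k → ∃ λ l →
  Feasible G r s k l × InS G r s k l σ

-- subgroup of S_n generated by a set P (permutations compared pointwise)
data ⟨_⟩ {n} (P : Permutation′ n → Set) : Permutation′ n → Set where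
  gen : ∀ {σ} → P σ → ⟨ P ⟩ σ
  one : ⟨ P ⟩ id
  mul : ∀ {σ τ} → ⟨ P ⟩ σ → ⟨ P ⟩ τ → ⟨ P ⟩ (σ ∘ₚ τ)
  inv : ∀ {σ} → ⟨ P ⟩ σ → ⟨ P ⟩ (flip σ)
  ext : ∀ {σ τ} → ⟨ P ⟩ σ → σ ≈ τ → ⟨ P ⟩ τ

LocalAmoeba : ∀ {n} → Graph n → Set
LocalAmoeba {n} G = ∀ (σ : Permutation′ n) → ⟨ Generator G ⟩ σ

_∪K₁ : ∀ {n} → Graph n → (t : ℕ) → Graph (n + t)
(_∪K₁ {n} G t) x y with splitAt n x | splitAt n y
... | inj₁ a | inj₁ b = G a b
... | _      | _      = false

GlobalAmoeba : ∀ {n} → Graph n → Set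
GlobalAmoeba G = ∃ λ T → ∀ t → T ≤ t → LocalAmoeba ((G ∪K₁) t)

module Submission where

-- Weighting v_i ∈ A by i, v_{q+j} ∈ B by n - j and isolated vertices by 0
-- makes H_n ∪ tK₁ a threshold graph: distinct vertices are adjacent iff their
-- weights sum to at least n.  In a threshold graph G, exchanging two vertices
-- of equal weight is an automorphism (replacement e → e), and exchanging x with
-- a y one unit lighter realises xz → yz when z is the unique partner of x
-- exactly at the threshold.  These moves link every vertex of H_n ∪ tK₁ to v_1,
-- so by conjugation S_G contains all transpositions and S_G = S_{n+t}.  The
-- parameters follow by counting: v_1 has the single neighbour v_{q+1}, there
-- are q(q+1)/2 + c(c-1)/2 = qc edges, and a clique meets A in at most one v_i,
-- whose neighbours in B are v_{q+1}, …, v_{q+i}.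

open import Data.Bool using (Bool; true; false; not; _∧_; _∨_; if_then_else_)
open import Data.Bool.Properties using (∧-zeroʳ; ∧-identityʳ; ∧-comm; ∨-comm; ∨-zeroʳ)
open import Data.Fin using (Fin; toℕ; splitAt; fromℕ<)
import Data.Fin as Fin
open import Data.Fin.Subset using (Subset; _∈_; ∣_∣)
open import Data.Vec using ([]; _∷_; here; there)
import Data.Vec as Vec
open import Data.Vec.Properties using (lookup∘tabulate; []=⇒lookup)
open import Data.Fin.Subset.Properties using (_∈?_)
open import Data.Fin.Properties using (_≟_; any?; toℕ-injective; toℕ<n; toℕ-fromℕ<; toℕ-↑ˡ; toℕ-↑ʳ; splitAt⁻¹-↑ˡ; splitAt⁻¹-↑ʳ)
open import Data.Fin.Permutation using (Permutation′; _⟨$⟩ʳ_; _⟨$⟩ˡ_; _∘ₚ_; _≈_; id; flip; transpose; inverseˡ; inverseʳ)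
open import Data.Fin.Permutation.Transposition.List using (TranspositionList; eval; decompose; eval-decompose)
open import Data.List using ([]; _∷_; allFin; map; tabulate)
open import Data.List.Properties using (map-tabulate; map-cong)
open import Data.Nat.ListAction using (sum)
open import Data.Nat using (ℕ; zero; suc; _+_; _*_; _∸_; _/_; _%_; _≤_; _<_; s≤s; z≤n)
open import Data.Nat.DivMod using (+-distrib-/; m<n⇒m/n≡0; m<n⇒m%n≡m; m*n/n≡m; m*n%n≡0; m%n<n; m≡m%n+[m/n]*n; /-monoˡ-≤)
open import Data.Nat.Properties
  using ( module ≤-Reasoning; _≤?_; _<?_; +-comm; +-suc; +-assoc; +-identityʳ; *-distribʳ-+; *-comm; ≤-refl; ≤-trans; <-trans; <⇒≤; ≤-pred; ≤-reflexive; <-irrefl; ≤-antisym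
        ; m≤n⇒m≤1+n; n≤1+n; n<1+n; 1+n≢n; n≤0⇒n≡0; suc-injective; m<n+m; ≤∧≢⇒<; ≤⇒≯; ≰⇒>; <⇒≱; ≮⇒≥; <⇒≢; <-cmp; m∸n+n≡m; m+[n∸m]≡n; 0∸n≡0; m+n∸m≡n; m+n∸n≡m; ∸-monoˡ-≤; m≤m+n; m≤n+m
        ; +-mono-≤; +-monoˡ-≤; +-monoʳ-≤; +-monoʳ-<; +-monoˡ-<; *-cancelʳ-≡; [m+n]∸[m+o]≡n∸o; +-cancelˡ-≤; +-cancelʳ-≤; +-cancelˡ-<; +-cancelˡ-≡; +-cancelʳ-≡ )
  renaming (_≟_ to _≟ℕ_)
open import Data.Nat.Tactic.RingSolver using (solve-∀)
open import Relation.Binary.Definitions using (tri<; tri≈; tri>)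
open import Data.Empty using (⊥; ⊥-elim)
open import Data.Product using (_×_; _,_; ∃; proj₁; proj₂)
open import Data.Sum using (_⊎_; inj₁; inj₂; [_,_])
open import Relation.Binary.PropositionalEquality using (_≡_; _≢_; refl; sym; trans; cong; cong₂; subst; ≢-sym; module ≡-Reasoning)
open import Relation.Nullary using (Dec; yes; no; does; ¬_)
open import Relation.Nullary.Decidable using (dec-true; dec-false; does-⇔; toSum; _×-dec_)
open import Function.Bundles using (mk⇔)

open import Defs

from-does : ∀ {A : Set} (d : Dec A) → does d ≡ true → A
from-does (yes a) _ = a

==-refl : ∀ {N} (x : Fin N) → (x == x) ≡ true
==-refl x = dec-true (x ≟ x) refl

==-≢ : ∀ {N} {x y : Fin N} → x ≢ y → (x == y) ≡ false
==-≢ {x = x} {y} = dec-false (x ≟ y)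

==-sym : ∀ {N} (x y : Fin N) → (x == y) ≡ (y == x)
==-sym x y with x ≟ y
... | yes refl = sym (==-refl x)
... | no  x≢y  = sym (==-≢ (≢-sym x≢y))

==-perm : ∀ {N} (π : Permutation′ N) (a b : Fin N) → ((π ⟨$⟩ʳ a) == (π ⟨$⟩ʳ b)) ≡ (a == b)
==-perm π a b with a ≟ b
... | yes refl = ==-refl (π ⟨$⟩ʳ a)
... | no  a≢b  = ==-≢ λ πa≡πb → a≢b (trans (sym (inverseˡ π)) (trans (cong (π ⟨$⟩ˡ_) πa≡πb) (inverseˡ π)))

module _ {N : ℕ} (x y : Fin N) where

  swap-x : transpose x y ⟨$⟩ʳ x ≡ y
  swap-x rewrite ==-refl x = refl

  swap-y : transpose x y ⟨$⟩ʳ y ≡ x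
  swap-y with y ≟ x
  ... | yes y≡x = y≡x
  ... | no  _   rewrite ==-refl y = refl

  swap-other : ∀ {a} → a ≢ x → a ≢ y → transpose x y ⟨$⟩ʳ a ≡ a
  swap-other a≢x a≢y rewrite ==-≢ a≢x | ==-≢ a≢y = refl

data Position {N : ℕ} (x y a : Fin N) : Set where
  at-x      : a ≡ x → Position x y a
  at-y      : a ≢ x → a ≡ y → Position x y a
  elsewhere : a ≢ x → a ≢ y → Position x y a

position : ∀ {N} (x y a : Fin N) → Position x y a
position x y a with a ≟ x | a ≟ y
... | yes a≡x | _       = at-x a≡x
... | no  a≢x | yes a≡y = at-y a≢x a≡y
... | no  a≢x | no  a≢y = elsewhere a≢x a≢y

conjugate : ∀ {N} {i j k : Fin N} → i ≢ j → j ≢ k → i ≢ k →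
            (transpose i j ∘ₚ transpose j k) ∘ₚ transpose i j ≈ transpose i k
conjugate {i = i} {j} {k} i≢j j≢k i≢k m with position i j m
... | at-x refl
  rewrite swap-x i j | swap-x j k | swap-other i j (≢-sym i≢k) (≢-sym j≢k) | swap-x i k = refl
... | at-y _ refl
  rewrite swap-y i j | swap-other j k i≢j i≢k | swap-x i j | swap-other i k (≢-sym i≢j) j≢k = refl
... | elsewhere m≢i m≢j with m ≟ k
...   | yes refl rewrite swap-other i j m≢i m≢j | swap-y j m | swap-y i j | swap-y i m = refl
...   | no  m≢k
  rewrite swap-other i j m≢i m≢j | swap-other j k m≢j m≢k | swap-other i j m≢i m≢j
        | swap-other i k m≢i m≢k = refl

-- The subgroup generated by P contains every permutation as soon as it
-- contains every transposition; a transposition (i j) is reached from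
-- (i k) and (k j) by conjugation, so it suffices to connect all vertices.
module Generated {N : ℕ} (P : Permutation′ N → Set) where

  Tr : Fin N → Fin N → Set
  Tr i j = ⟨ P ⟩ (transpose i j)

  Tr-refl : ∀ i → Tr i i
  Tr-refl i = ext one id≈tii
    where
    id≈tii : id ≈ transpose i i
    id≈tii m with position i i m
    ... | at-x refl         = sym (swap-x m m)
    ... | at-y m≢i m≡i      = ⊥-elim (m≢i m≡i)
    ... | elsewhere m≢i _   = sym (swap-other i i m≢i m≢i)

  Tr-sym : ∀ {i j} → Tr i j → Tr j i
  Tr-sym {i} {j} t = ext t tij≈tji
    where
    tij≈tji : transpose i j ≈ transpose j i
    tij≈tji m with position i j m
    ... | at-x refl         = trans (swap-x m j) (sym (swap-y j m))
    ... | at-y _ refl       = trans (swap-y i m) (sym (swap-x m i))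
    ... | elsewhere m≢i m≢j = trans (swap-other i j m≢i m≢j) (sym (swap-other j i m≢j m≢i))

  Tr-trans : ∀ {i j k} → Tr i j → Tr j k → Tr i k
  Tr-trans {i} {j} {k} t u with i ≟ j | j ≟ k | i ≟ k
  ... | yes refl | _        | _        = u
  ... | no _     | yes refl | _        = t
  ... | no _     | no _     | yes refl = Tr-refl i
  ... | no i≢j   | no j≢k   | no i≢k   = ext (mul (mul t u) t) (conjugate i≢j j≢k i≢k)

  -- every permutation is a product of transpositions
  all-transpositions : (∀ i j → Tr i j) → ∀ π → ⟨ P ⟩ π
  all-transpositions tr π = ext (product (decompose π)) (eval-decompose π)
    where
    product : (ts : TranspositionList N) → ⟨ P ⟩ (eval ts)
    product []            = one
    product ((i , j) ∷ ts) = mul (tr i j) (product ts)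

samePair-refl : ∀ {N} (k l : Fin N) → samePair k l k l ≡ true
samePair-refl k l rewrite ==-refl k | ==-refl l = refl

pair-≢ : ∀ {N} {u v u′ v′ : Fin N} → u ≢ u′ ⊎ v ≢ v′ → ((u == u′) ∧ (v == v′)) ≡ false
pair-≢ (inj₁ u≢u′) rewrite ==-≢ u≢u′ = refl
pair-≢ {u = u} {u′ = u′} (inj₂ v≢v′) rewrite ==-≢ v≢v′ = ∧-zeroʳ (u == u′)

samePair-false : ∀ {N} {k l : Fin N} (a b : Fin N) → a ≢ k ⊎ b ≢ l → a ≢ l ⊎ b ≢ k →
                 samePair a b k l ≡ false
samePair-false _ _ p q rewrite pair-≢ p | pair-≢ q = refl

samePair-sym : ∀ {N} (a b k l : Fin N) → samePair a b k l ≡ samePair b a k l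
samePair-sym a b k l =
  trans (cong₂ _∨_ (∧-comm (a == k) (b == l)) (∧-comm (a == l) (b == k)))
        (∨-comm ((b == l) ∧ (a == k)) ((b == k) ∧ (a == l)))

module _ {N : ℕ} {G : Graph N} {r s k l : Fin N} where

  replace-away : ∀ {a b} → samePair a b k l ≡ false → samePair a b r s ≡ false →
                 replace G r s k l a b ≡ G a b
  replace-away {a} {b} p q rewrite p | q = ∧-identityʳ (G a b)

  replace-added : ∀ {a b} → samePair a b k l ≡ true → replace G r s k l a b ≡ true
  replace-added p rewrite p = refl

  replace-removed : ∀ {a b} → samePair a b k l ≡ false → samePair a b r s ≡ true →
                    replace G r s k l a b ≡ false
  replace-removed {a} {b} p q rewrite p | q = ∧-zeroʳ (G a b)

  replace-sym : (∀ a b → G a b ≡ G b a) → ∀ a b → replace G r s k l a b ≡ replace G r s k l b a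
  replace-sym G-sym a b
    rewrite samePair-sym a b k l | samePair-sym a b r s | G-sym a b = refl

samePair-true : ∀ {N} {a b k l : Fin N} → samePair a b k l ≡ true → (a ≡ k × b ≡ l) ⊎ (a ≡ l × b ≡ k)
samePair-true {a = a} {b} {k} {l} e with a ≟ k | b ≟ l | a ≟ l | b ≟ k
... | yes a≡k | yes b≡l | _       | _       = inj₁ (a≡k , b≡l)
... | _       | _       | yes a≡l | yes b≡k = inj₂ (a≡l , b≡k)
... | yes _   | no _    | yes _   | no _    with () ← e
... | yes _   | no _    | no _    | _       with () ← e
... | no _    | _       | yes _   | no _    with () ← e
... | no _    | _       | no _    | _       with () ← e

replace-self : ∀ {N} {G : Graph N} {r s : Fin N} → (∀ a b → G a b ≡ G b a) → G r s ≡ true →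
               replace G r s r s ≐ G
replace-self {G = G} {r} {s} G-sym rs a b with samePair a b r s in e
... | false = ∧-identityʳ (G a b)
... | true with samePair-true {a = a} {b} {r} {s} e
...   | inj₁ (refl , refl) = sym rs
...   | inj₂ (refl , refl) = sym (trans (G-sym a b) rs)

module _ {N : ℕ} {G : Graph N} {r s k l : Fin N} {σ : Permutation′ N} where

  realised-replacement-iso : InS G r s k l σ → replace G r s k l ≅ G
  realised-replacement-iso realises =
    flip σ , λ a b → trans (sym (realises (flip σ ⟨$⟩ʳ a) (flip σ ⟨$⟩ʳ b))) (cong₂ G (inverseʳ σ) (inverseʳ σ))

  replacement-generator : r ≢ s → G r s ≡ true → k ≢ l → G k l ≡ false →
                          InS G r s k l σ → Generator G σ
  replacement-generator r≢s rs k≢l kl realises =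
    r , s , k , l , (r≢s , rs , inj₁ (k≢l , kl) , realised-replacement-iso realises) , realises

-- every automorphism of a graph with at least one edge is a generator of S_G,
-- realising the trivial replacement rs → rs
automorphism-generator : ∀ {N} {G : Graph N} {r s : Fin N} {σ : Permutation′ N} →
                         (∀ a b → G a b ≡ G b a) → r ≢ s → G r s ≡ true → G [ σ ] ≐ G → Generator G σ
automorphism-generator {G = G} {r} {s} {σ} G-sym r≢s rs aut =
  r , s , r , s , (r≢s , rs , inj₂ (samePair-refl r s) , realised-replacement-iso {G = G} {r} {s} {r} {s} {σ} realises) , realises
  where
  realises : InS G r s r s σ
  realises a b = trans (aut a b) (sym (replace-self {G = G} G-sym rs a b))

module Threshold {N : ℕ} (w : Fin N → ℕ) (M : ℕ) where

  T : Graph N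
  T x y = not (x == y) ∧ does (M ≤? w x + w y)

  T-irrefl : ∀ x → T x x ≡ false
  T-irrefl x rewrite ==-refl x = refl

  T-sym : ∀ x y → T x y ≡ T y x
  T-sym x y rewrite ==-sym x y | +-comm (w x) (w y) = refl

  swap-same-weight : ∀ {x y} → w x ≡ w y → ∀ a → w (transpose x y ⟨$⟩ʳ a) ≡ w a
  swap-same-weight {x} {y} wx≡wy a with position x y a
  ... | at-x refl         rewrite swap-x a y = sym wx≡wy
  ... | at-y _ refl       rewrite swap-y x a = wx≡wy
  ... | elsewhere a≢x a≢y rewrite swap-other x y a≢x a≢y = refl

  equal-weight-automorphism : ∀ {x y} → w x ≡ w y → T [ transpose x y ] ≐ T
  equal-weight-automorphism {x} {y} wx≡wy a b
    rewrite ==-perm (transpose x y) a b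
          | swap-same-weight wx≡wy a | swap-same-weight wx≡wy b = refl

  record Shift (x y z : Fin N) : Set where
    field
      x≢y            : x ≢ y
      z≢x            : z ≢ x
      z≢y            : z ≢ y
      one-above      : w x ≡ suc (w y)
      partner        : w z + w x ≡ M
      unique-partner : ∀ b → b ≢ x → b ≢ y → b ≢ z → w b + w x ≢ M

  module _ {x y z : Fin N} (shift : Shift x y z) where
    open Shift shift

    xz-edge : T x z ≡ true
    xz-edge rewrite ==-≢ (≢-sym z≢x) =
      dec-true (M ≤? w x + w z) (≤-reflexive (trans (sym partner) (+-comm (w z) (w x))))

    yz-non-edge : T y z ≡ false
    yz-non-edge rewrite ==-≢ (≢-sym z≢y) = dec-false (M ≤? w y + w z) above
      where
      M≡1+wy+wz : M ≡ suc (w y + w z)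
      M≡1+wy+wz = trans (sym partner) (trans (cong (w z +_) one-above)
                    (trans (+-suc (w z) (w y)) (cong suc (+-comm (w z) (w y)))))
      above : ¬ M ≤ w y + w z
      above M≤ = <-irrefl refl (subst (_≤ w y + w z) M≡1+wy+wz M≤)

    same-row : ∀ b → b ≢ x → b ≢ y → b ≢ z → T y b ≡ T x b
    same-row b b≢x b≢y b≢z rewrite ==-≢ (≢-sym b≢y) | ==-≢ (≢-sym b≢x) | one-above =
      does-⇔ (mk⇔ m≤n⇒m≤1+n below-threshold) (M ≤? w y + w b) (M ≤? suc (w y + w b))
      where
      below-threshold : M ≤ suc (w y + w b) → M ≤ w y + w b
      below-threshold M≤ = ≤-pred (≤∧≢⇒< M≤ λ M≡ →
        unique-partner b b≢x b≢y b≢z (trans (+-comm (w b) (w x)) (sym (trans M≡ (cong (_+ w b) (sym one-above))))))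

    private
      R : Graph N
      R = replace T x z y z

      π : Permutation′ N
      π = transpose x y

      x≢z = ≢-sym z≢x
      y≢z = ≢-sym z≢y
      y≢x = ≢-sym x≢y

      R-sym : ∀ a b → R a b ≡ R b a
      R-sym = replace-sym T-sym

      R-away : ∀ a b → samePair a b y z ≡ false → samePair a b x z ≡ false → R a b ≡ T a b
      R-away a b = replace-away {G = T} {x} {z} {y} {z} {a} {b}

      R-added : ∀ a b → samePair a b y z ≡ true → R a b ≡ true
      R-added a b = replace-added {G = T} {x} {z} {y} {z} {a} {b}

      R-removed : ∀ a b → samePair a b y z ≡ false → samePair a b x z ≡ true → R a b ≡ false
      R-removed a b = replace-removed {G = T} {x} {z} {y} {z} {a} {b}

    x-row : ∀ b → b ≢ x → b ≢ y → T y b ≡ R x b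
    x-row b b≢x b≢y with toSum (b ≟ z)
    ... | inj₁ refl = trans yz-non-edge (sym (R-removed x b
                       (samePair-false x b (inj₁ x≢y) (inj₁ x≢z)) (samePair-refl x b)))
    ... | inj₂ b≢z  = trans (same-row b b≢x b≢y b≢z) (sym (R-away x b
                       (samePair-false x b (inj₁ x≢y) (inj₁ x≢z)) (samePair-false x b (inj₂ b≢z) (inj₁ x≢z))))

    y-row : ∀ b → b ≢ x → b ≢ y → T x b ≡ R y b
    y-row b b≢x b≢y with toSum (b ≟ z)
    ... | inj₁ refl = trans xz-edge (sym (R-added y b (samePair-refl y b)))
    ... | inj₂ b≢z  = trans (sym (same-row b b≢x b≢y b≢z)) (sym (R-away y b
                       (samePair-false y b (inj₂ b≢z) (inj₁ y≢z)) (samePair-false y b (inj₁ y≢x) (inj₁ y≢z))))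

    shift-replace : T [ π ] ≐ R
    shift-replace a b with position x y a | position x y b
    ... | at-x refl | at-x refl = trans (cong₂ T (swap-x x y) (swap-x x y)) (trans (T-irrefl y) (sym
            (trans (R-away x x (samePair-false x x (inj₁ x≢y) (inj₁ x≢z)) (samePair-false x x (inj₂ x≢z) (inj₁ x≢z)))
                   (T-irrefl x))))
    ... | at-y _ refl | at-y _ refl = trans (cong₂ T (swap-y x y) (swap-y x y)) (trans (T-irrefl x) (sym
            (trans (R-away y y (samePair-false y y (inj₂ y≢z) (inj₁ y≢z)) (samePair-false y y (inj₁ y≢x) (inj₁ y≢z)))
                   (T-irrefl y))))
    ... | at-x refl | at-y _ refl = trans (cong₂ T (swap-x x y) (swap-y x y)) (trans (T-sym y x) (sym
            (R-away x y (samePair-false x y (inj₁ x≢y) (inj₁ x≢z)) (samePair-false x y (inj₂ y≢z) (inj₁ x≢z)))))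
    ... | at-y _ refl | at-x refl = trans (cong₂ T (swap-y x y) (swap-x x y)) (trans (T-sym x y) (sym
            (R-away y x (samePair-false y x (inj₂ x≢z) (inj₁ y≢z)) (samePair-false y x (inj₁ y≢x) (inj₁ y≢z)))))
    ... | at-x refl | elsewhere b≢x b≢y =
            trans (cong₂ T (swap-x x y) (swap-other x y b≢x b≢y)) (x-row b b≢x b≢y)
    ... | at-y _ refl | elsewhere b≢x b≢y =
            trans (cong₂ T (swap-y x y) (swap-other x y b≢x b≢y)) (y-row b b≢x b≢y)
    ... | elsewhere a≢x a≢y | at-x refl =
            trans (cong₂ T (swap-other x y a≢x a≢y) (swap-x x y)) (trans (T-sym a y) (trans (x-row a a≢x a≢y) (R-sym x a)))
    ... | elsewhere a≢x a≢y | at-y _ refl =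
            trans (cong₂ T (swap-other x y a≢x a≢y) (swap-y x y)) (trans (T-sym a x) (trans (y-row a a≢x a≢y) (R-sym y a)))
    ... | elsewhere a≢x a≢y | elsewhere b≢x b≢y =
            trans (cong₂ T (swap-other x y a≢x a≢y) (swap-other x y b≢x b≢y)) (sym
              (R-away a b (samePair-false a b (inj₁ a≢y) (inj₂ b≢y)) (samePair-false a b (inj₁ a≢x) (inj₂ b≢x))))

  module _ {G : Graph N} (G≐T : G ≐ T) where

    private
      G-sym : ∀ a b → G a b ≡ G b a
      G-sym a b = trans (G≐T a b) (trans (T-sym a b) (sym (G≐T b a)))

    equal-weight-generator : ∀ {x y r s} → w x ≡ w y → r ≢ s → T r s ≡ true → Generator G (transpose x y)
    equal-weight-generator {x} {y} {r} {s} wx≡wy r≢s rs =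
      automorphism-generator {G = G} {σ = transpose x y} G-sym r≢s (trans (G≐T r s) rs) automorphism
      where
      automorphism : G [ transpose x y ] ≐ G
      automorphism a b = trans (G≐T _ _) (trans (equal-weight-automorphism wx≡wy a b) (sym (G≐T a b)))

    shift-generator : ∀ {x y z} → Shift x y z → Generator G (transpose x y)
    shift-generator {x} {y} {z} shift =
      replacement-generator {G = G} {x} {z} {y} {z} {transpose x y} (≢-sym z≢x) (trans (G≐T x z) (xz-edge shift))
                            (≢-sym z≢y) (trans (G≐T y z) (yz-non-edge shift)) realises
      where
      open Shift shift
      realises : InS G x z y z (transpose x y)
      realises a b = trans (G≐T _ _) (trans (shift-replace shift a b)
                       (cong (λ e → samePair a b y z ∨ (e ∧ not (samePair a b x z))) (sym (G≐T a b))))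

distinct-sum : ∀ {a b k} → a ≢ b → a < k → b < k → suc (suc a + suc b) ≤ k + k
distinct-sum {a} {b} a≢b a<k b<k with <-cmp a b
... | tri< a<b _ _ = +-mono-≤ (≤-trans (s≤s a<b) b<k) b<k
... | tri≈ _ a≡b _ = ⊥-elim (a≢b a≡b)
... | tri> _ _ b<a = ≤-trans (≤-reflexive (sym (+-suc (suc a) (suc b)))) (+-mono-≤ a<k (≤-trans (s≤s b<a) a<k))

-- The vertices of H_n, numbered 0 … n-1, split as A = [0, q) and B = [q, n)
-- with n ∈ {2q, 2q+1} and q ≥ 1; numbers ≥ n stand for added isolated vertices.
module HalfSplit (n q : ℕ) (n≡2q∨2q+1 : n ≡ q + q ⊎ n ≡ suc (q + q)) (1≤q : 1 ≤ q) where

  2q≤n : q + q ≤ n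
  2q≤n = [ (λ n≡2q → ≤-reflexive (sym n≡2q)) , (λ n≡2q+1 → ≤-trans (n≤1+n (q + q)) (≤-reflexive (sym n≡2q+1))) ]
           n≡2q∨2q+1

  n≤2q+1 : n ≤ suc (q + q)
  n≤2q+1 = [ (λ n≡2q → ≤-trans (≤-reflexive n≡2q) (n≤1+n (q + q))) , ≤-reflexive ] n≡2q∨2q+1

  q<n : q < n
  q<n = ≤-trans (≤-reflexive (+-comm 1 q)) (≤-trans (+-monoʳ-≤ q 1≤q) 2q≤n)

  data Part (m : ℕ) : Set where
    in-A     : m < q → Part m
    in-B     : q ≤ m → m < n → Part m
    isolated : n ≤ m → Part m

  part : ∀ m → Part m
  part m with m <? q | m <? n
  ... | yes m<q | _       = in-A m<q
  ... | no  m≮q | yes m<n = in-B (≮⇒≥ m≮q) m<n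
  ... | no  _   | no  m≮n = isolated (≮⇒≥ m≮n)

  -- Weights: vertex v_i ∈ A (index i-1) weighs i, vertex v_{q+j} ∈ B weighs
  -- n - j, isolated vertices weigh 0; adjacency is "weights add up to ≥ n".
  weight : ℕ → ℕ
  weight m = if does (m <? q) then suc m else (if does (m <? n) then n + q ∸ suc m else 0)

  weight-A : ∀ {m} → m < q → weight m ≡ suc m
  weight-A {m} m<q rewrite dec-true (m <? q) m<q = refl

  weight-B : ∀ {m} → q ≤ m → m < n → weight m + suc m ≡ n + q
  weight-B {m} q≤m m<n rewrite dec-false (m <? q) (≤⇒≯ q≤m) | dec-true (m <? n) m<n =
    m∸n+n≡m (≤-trans m<n (m≤m+n n q))

  weight-isolated : ∀ {m} → n ≤ m → weight m ≡ 0
  weight-isolated {m} n≤m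
    rewrite dec-false (m <? q) (≤⇒≯ (≤-trans (<⇒≤ q<n) n≤m)) | dec-false (m <? n) (≤⇒≯ n≤m) = refl

  -- no weight reaches n, so an isolated vertex (weight 0) is adjacent to nothing
  weight<n : ∀ m → weight m < n
  weight<n m with part m
  ... | in-A m<q = ≤-trans (≤-reflexive (cong suc (weight-A m<q))) (≤-trans (s≤s m<q) q<n)
  ... | in-B q≤m m<n = +-cancelʳ-≤ (suc m) (suc (weight m)) n (≤-trans (≤-reflexive (cong suc (weight-B q≤m m<n)))
                          (≤-trans (≤-reflexive (sym (+-suc n q))) (+-monoʳ-≤ n (s≤s q≤m))))
  ... | isolated n≤m rewrite weight-isolated n≤m = ≤-trans (s≤s z≤n) q<n

  Adj : ℕ → ℕ → Bool
  Adj a b = not (does (a ≟ℕ b)) ∧ does (n ≤? weight a + weight b)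

  Adj-irrefl : ∀ a → Adj a a ≡ false
  Adj-irrefl a rewrite dec-true (a ≟ℕ a) refl = refl

  Adj-sym : ∀ a b → Adj a b ≡ Adj b a
  Adj-sym a b rewrite does-⇔ (mk⇔ sym sym) (a ≟ℕ b) (b ≟ℕ a) | +-comm (weight a) (weight b) = refl

  adj-AA : ∀ {a b} → a < q → b < q → adjℕ q a b ≡ false
  adj-AA {a} {b} a<q b<q rewrite dec-true (a <? q) a<q | dec-true (b <? q) b<q = refl

  adj-BB : ∀ {a b} → q ≤ a → q ≤ b → adjℕ q a b ≡ not (does (a ≟ℕ b))
  adj-BB {a} {b} q≤a q≤b rewrite dec-false (a <? q) (≤⇒≯ q≤a) | dec-false (b <? q) (≤⇒≯ q≤b) = refl

  adj-AB : ∀ {a b} → a < q → q ≤ b → adjℕ q a b ≡ does (b ≤? a + q)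
  adj-AB {a} {b} a<q q≤b rewrite dec-true (a <? q) a<q | dec-false (b <? q) (≤⇒≯ q≤b) = refl

  adj-BA : ∀ {a b} → q ≤ a → b < q → adjℕ q a b ≡ does (a ≤? b + q)
  adj-BA {a} {b} q≤a b<q rewrite dec-false (a <? q) (≤⇒≯ q≤a) | dec-true (b <? q) b<q = refl

  -- v_i ~ v_{q+j} iff j ≤ i, i.e. iff i + (n - j) ≥ n
  adj-threshold-AB : ∀ {a b} → a < q → q ≤ b → b < n → adjℕ q a b ≡ Adj a b
  adj-threshold-AB {a} {b} a<q q≤b b<n
    rewrite adj-AB a<q q≤b | dec-false (a ≟ℕ b) (<⇒≢ (≤-trans a<q q≤b)) | weight-A a<q =
    does-⇔ (mk⇔ to from) (b ≤? a + q) (n ≤? suc a + weight b)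
    where
    key : (suc a + weight b) + suc b ≡ n + suc (a + q)
    key = trans (+-assoc (suc a) (weight b) (suc b))
                (trans (cong (suc a +_) (weight-B q≤b b<n)) (rearrange a n q))
      where
      rearrange : ∀ a n q → suc a + (n + q) ≡ n + suc (a + q)
      rearrange = solve-∀
    to : b ≤ a + q → n ≤ suc a + weight b
    to b≤a+q = +-cancelʳ-≤ (suc b) n _ (≤-trans (+-monoʳ-≤ n (s≤s b≤a+q)) (≤-reflexive (sym key)))
    from : n ≤ suc a + weight b → b ≤ a + q
    from n≤ = ≤-pred (+-cancelˡ-≤ n _ _ (≤-trans (+-monoˡ-≤ (suc b) n≤) (≤-reflexive key)))

  -- two A-vertices weigh at most 2q - 1 < n together
  adj-threshold-AA : ∀ {a b} → a < q → b < q → adjℕ q a b ≡ Adj a b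
  adj-threshold-AA {a} {b} a<q b<q with toSum (a ≟ℕ b)
  ... | inj₁ refl = trans (adj-AA a<q b<q) (sym (Adj-irrefl a))
  ... | inj₂ a≢b rewrite adj-AA a<q b<q | dec-false (a ≟ℕ b) a≢b | weight-A a<q | weight-A b<q =
    sym (dec-false (n ≤? suc a + suc b) (<⇒≱ (≤-trans (distinct-sum a≢b a<q b<q) 2q≤n)))

  -- two B-vertices weigh at least 2q + 1 ≥ n together
  adj-threshold-BB : ∀ {a b} → q ≤ a → a < n → q ≤ b → b < n → adjℕ q a b ≡ Adj a b
  adj-threshold-BB {a} {b} q≤a a<n q≤b b<n with toSum (a ≟ℕ b)
  ... | inj₁ refl = trans (adj-BB q≤a q≤b) (trans (cong not (dec-true (a ≟ℕ a) refl)) (sym (Adj-irrefl a)))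
  ... | inj₂ a≢b rewrite adj-BB q≤a q≤b | dec-false (a ≟ℕ b) a≢b = sym (dec-true (n ≤? weight a + weight b) (+-cancelʳ-≤ (suc a + suc b) n _ n+s≤))
    where
    total : (weight a + weight b) + (suc a + suc b) ≡ (n + q) + (n + q)
    total = trans (regroup (weight a) (weight b) (suc a) (suc b)) (cong₂ _+_ (weight-B q≤a a<n) (weight-B q≤b b<n))
      where
      regroup : ∀ u v s t → (u + v) + (s + t) ≡ (u + s) + (v + t)
      regroup = solve-∀
    s≤ : suc a + suc b ≤ n + (q + q)
    s≤ = ≤-pred (≤-trans (distinct-sum a≢b a<n b<n)
                 (≤-trans (+-monoʳ-≤ n n≤2q+1) (≤-reflexive (+-suc n (q + q)))))
    n+s≤ : n + (suc a + suc b) ≤ (weight a + weight b) + (suc a + suc b)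
    n+s≤ = ≤-trans (+-monoʳ-≤ n s≤) (≤-reflexive (trans (double n q) (sym total)))
      where
      double : ∀ n q → n + (n + (q + q)) ≡ (n + q) + (n + q)
      double = solve-∀

  adj-threshold : ∀ {a b} → a < n → b < n → adjℕ q a b ≡ Adj a b
  adj-threshold {a} {b} a<n b<n with part a | part b
  ... | in-A a<q     | in-A b<q     = adj-threshold-AA a<q b<q
  ... | in-A a<q     | in-B q≤b _   = adj-threshold-AB a<q q≤b b<n
  ... | in-B q≤a _   | in-A b<q     =
    trans (adj-BA q≤a b<q) (trans (sym (adj-AB b<q q≤a)) (trans (adj-threshold-AB b<q q≤a a<n) (Adj-sym b a)))
  ... | in-B q≤a _   | in-B q≤b _   = adj-threshold-BB q≤a a<n q≤b b<n
  ... | isolated n≤a | _            = ⊥-elim (<⇒≱ a<n n≤a)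
  ... | _            | isolated n≤b = ⊥-elim (<⇒≱ b<n n≤b)

  isolated-non-adjacent : ∀ {a} → n ≤ a → ∀ b → Adj b a ≡ false
  isolated-non-adjacent {a} n≤a b
    rewrite weight-isolated n≤a | +-identityʳ (weight b) | dec-false (n ≤? weight b) (<⇒≱ (weight<n b)) =
    ∧-zeroʳ (not (does (b ≟ℕ a)))

  beyond : ∀ {t} {v : Fin (n + t)} {c : Fin t} → splitAt n v ≡ inj₂ c → n ≤ toℕ v
  beyond {c = c} e = ≤-trans (m≤m+n n (toℕ c)) (≤-reflexive (trans (sym (toℕ-↑ʳ n c)) (cong toℕ (splitAt⁻¹-↑ʳ e))))

  Weighted : (N : ℕ) → Graph N
  Weighted N = Threshold.T (λ (x : Fin N) → weight (toℕ x)) n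

  Weighted-Adj : ∀ {N} (x y : Fin N) → Weighted N x y ≡ Adj (toℕ x) (toℕ y)
  Weighted-Adj x y = cong (λ e → not e ∧ does (n ≤? weight (toℕ x) + weight (toℕ y))) (does-⇔ (mk⇔ (cong toℕ) toℕ-injective) (x ≟ y) (toℕ x ≟ℕ toℕ y))

  adjℕ-weighted : (λ (x y : Fin n) → adjℕ q (toℕ x) (toℕ y)) ≐ Weighted n
  adjℕ-weighted x y = trans (adj-threshold (toℕ<n x) (toℕ<n y)) (sym (Weighted-Adj x y))

  isolated-weighted : ∀ {G : Graph n} t → G ≐ Weighted n → (G ∪K₁) t ≐ Weighted (n + t)
  isolated-weighted {G} t G≐W x y with splitAt n x in split-x | splitAt n y in split-y
  ... | inj₁ a | inj₁ b = trans (G≐W a b) (trans (Weighted-Adj a b)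
                            (trans (cong₂ Adj (same-index split-x) (same-index split-y)) (sym (Weighted-Adj x y))))
    where
    same-index : ∀ {v : Fin (n + t)} {c : Fin n} → splitAt n v ≡ inj₁ c → toℕ c ≡ toℕ v
    same-index {c = c} e = trans (sym (toℕ-↑ˡ c t)) (cong toℕ (splitAt⁻¹-↑ˡ e))
  ... | inj₂ _ | _      = sym (trans (Weighted-Adj x y) (trans (Adj-sym (toℕ x) (toℕ y)) (isolated-non-adjacent (beyond split-x) (toℕ y))))
  ... | inj₁ _ | inj₂ _ = sym (trans (Weighted-Adj x y) (isolated-non-adjacent (beyond split-y) (toℕ x)))

  record IndexShift (a b c : ℕ) : Set where
    field
      a≢b            : a ≢ b
      c≢a            : c ≢ a
      c≢b            : c ≢ b
      c<n            : c < n
      one-above      : weight a ≡ suc (weight b)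
      partner        : weight c + weight a ≡ n
      unique-partner : ∀ m → m ≢ a → m ≢ b → m ≢ c → weight m + weight a ≢ n

  vertex-shift : ∀ {N} {x y z : Fin N} → IndexShift (toℕ x) (toℕ y) (toℕ z) →
                 Threshold.Shift (λ (v : Fin N) → weight (toℕ v)) n x y z
  vertex-shift s = record
    { x≢y            = λ x≡y → a≢b (cong toℕ x≡y)
    ; z≢x            = λ z≡x → c≢a (cong toℕ z≡x)
    ; z≢y            = λ z≡y → c≢b (cong toℕ z≡y)
    ; one-above      = one-above
    ; partner        = partner
    ; unique-partner = λ v v≢x v≢y v≢z →
        unique-partner (toℕ v) (λ e → v≢x (toℕ-injective e)) (λ e → v≢y (toℕ-injective e)) (λ e → v≢z (toℕ-injective e))
    }
    where open IndexShift s

  tight : ∀ {x y k} → x ≤ k → y ≤ k → k + k ≤ x + y → x ≡ k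
  tight {x} {y} {k} x≤k y≤k 2k≤ = ≤-antisym x≤k (+-cancelʳ-≤ k k x (≤-trans 2k≤ (+-monoʳ-≤ x y≤k)))

  -- v_{u+2}, v_{u+1} ∈ A are exchanged by the move v_{u+2} v_{q+u+2} → v_{u+1} v_{q+u+2}
  A-step : ∀ u → suc u < q → IndexShift (suc u) u (q + suc u)
  A-step u 1+u<q = record
    { a≢b            = 1+n≢n
    ; c≢a            = ≢-sym (<⇒≢ 1+u<c)
    ; c≢b            = ≢-sym (<⇒≢ (<-trans (n<1+n u) 1+u<c))
    ; c<n            = c<n
    ; one-above      = trans (weight-A 1+u<q) (cong suc (sym (weight-A (<-trans (n<1+n u) 1+u<q))))
    ; partner        = trans (cong (weight c +_) (weight-A 1+u<q)) partner′
    ; unique-partner = unique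
    }
    where
    c = q + suc u
    1+u<c : suc u < c
    1+u<c = m<n+m (suc u) 1≤q
    c<n : c < n
    c<n = ≤-trans (+-monoʳ-< q 1+u<q) 2q≤n
    rearrange : ∀ w u q → (w + suc (suc u)) + q ≡ w + suc (q + suc u)
    rearrange = solve-∀
    partner′ : weight c + suc (suc u) ≡ n
    partner′ = +-cancelʳ-≡ q _ _ (trans (rearrange (weight c) u q) (weight-B (m≤m+n q (suc u)) c<n))
    unique : ∀ m → m ≢ suc u → m ≢ u → m ≢ c → weight m + weight (suc u) ≢ n
    unique m m≢1+u _ m≢c e with part m
    ... | in-A m<q = m≢1+u (suc-injective (trans (tight m<q 1+u<q 2q≤) (sym (tight 1+u<q m<q 2q≤′))))
      where
      sum≡n : suc m + suc (suc u) ≡ n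
      sum≡n = trans (cong₂ _+_ (sym (weight-A m<q)) (sym (weight-A 1+u<q))) e
      2q≤ : q + q ≤ suc m + suc (suc u)
      2q≤ = ≤-trans 2q≤n (≤-reflexive (sym sum≡n))
      2q≤′ : q + q ≤ suc (suc u) + suc m
      2q≤′ = ≤-trans 2q≤ (≤-reflexive (+-comm (suc m) (suc (suc u))))
    ... | in-B q≤m m<n = m≢c (suc-injective (+-cancelˡ-≡ (weight m) _ _
            (trans (weight-B q≤m m<n) (trans (cong (_+ q) (sym e′)) (rearrange (weight m) u q)))))
      where
      e′ : weight m + suc (suc u) ≡ n
      e′ = trans (cong (weight m +_) (sym (weight-A 1+u<q))) e
    ... | isolated n≤m = <-irrefl (sym n≡2+u) (≤-trans (s≤s 1+u<q) q<n)
      where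
      n≡2+u : n ≡ suc (suc u)
      n≡2+u = trans (sym e) (cong₂ _+_ (weight-isolated n≤m) (weight-A 1+u<q))

  -- v_{q+d+1}, v_{q+d+2} ∈ B are exchanged by the move v_{q+d+1} v_{d+1} → v_{q+d+2} v_{d+1}
  B-step : ∀ d → suc (q + d) < n → IndexShift (q + d) (suc (q + d)) d
  B-step d 2+q+d≤n = record
    { a≢b            = <⇒≢ (n<1+n (q + d))
    ; c≢a            = <⇒≢ d<q+d
    ; c≢b            = <⇒≢ (<-trans d<q+d (n<1+n (q + d)))
    ; c<n            = <-trans d<q q<n
    ; one-above      = +-cancelʳ-≡ (suc (q + d)) _ _
                         (trans (weight-B q≤q+d q+d<n) (trans (sym (weight-B (m≤n⇒m≤1+n q≤q+d) 2+q+d≤n))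
                                                              (+-suc (weight (suc (q + d))) (suc (q + d)))))
    ; partner        = trans (cong (_+ weight (q + d)) (weight-A d<q)) partner′
    ; unique-partner = unique
    }
    where
    d<q+d : d < q + d
    d<q+d = m<n+m d 1≤q
    q≤q+d : q ≤ q + d
    q≤q+d = m≤m+n q d
    q+d<n : q + d < n
    q+d<n = <-trans (n<1+n (q + d)) 2+q+d≤n
    d<q : d < q
    d<q = +-cancelˡ-< q d q (≤-pred (≤-trans 2+q+d≤n n≤2q+1))
    partner′ : suc d + weight (q + d) ≡ n
    partner′ = +-cancelʳ-≡ q _ _ (trans (rearrange (weight (q + d)) d q) (weight-B q≤q+d q+d<n))
      where
      rearrange : ∀ w d q → (suc d + w) + q ≡ w + suc (q + d)
      rearrange = solve-∀
    unique : ∀ m → m ≢ q + d → m ≢ suc (q + d) → m ≢ d → weight m + weight (q + d) ≢ n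
    unique m _ m≢2+q+d m≢d e = by-part (part m)
      where
      weight-m : weight m ≡ suc d
      weight-m = +-cancelʳ-≡ (weight (q + d)) _ _ (trans e (sym partner′))
      by-part : Part m → ⊥
      by-part (in-A m<q)     = m≢d (suc-injective (trans (sym (weight-A m<q)) weight-m))
      by-part (isolated n≤m) with () ← trans (sym (weight-isolated n≤m)) weight-m
      -- an m ∈ B weighing d + 1 forces d + 1 = q and m = n - 1 = 2q
      by-part (in-B q≤m m<n) = m≢2+q+d (≤-antisym m≤y y≤m)
        where
        total : suc d + suc m ≡ n + q
        total = trans (cong (_+ suc m) (sym weight-m)) (weight-B q≤m m<n)
        1+d≡q : suc d ≡ q
        1+d≡q = ≤-antisym d<q (+-cancelʳ-≤ n q (suc d)
                  (≤-trans (≤-reflexive (trans (+-comm q n) (sym total))) (+-monoʳ-≤ (suc d) m<n)))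
        1+m≡n : suc m ≡ n
        1+m≡n = +-cancelˡ-≡ q _ _ (trans (cong (_+ suc m) (sym 1+d≡q)) (trans total (+-comm n q)))
        m≤y : m ≤ suc (q + d)
        m≤y = ≤-pred (≤-trans (≤-reflexive 1+m≡n)
                       (≤-trans n≤2q+1 (≤-reflexive (cong suc (trans (cong (q +_) (sym 1+d≡q)) (+-suc q d))))))
        y≤m : suc (q + d) ≤ m
        y≤m = ≤-pred (≤-trans 2+q+d≤n (≤-reflexive (sym 1+m≡n)))

  2≤n : 2 ≤ n
  2≤n = ≤-trans (+-mono-≤ 1≤q 1≤q) 2q≤n

  weight-q : weight q + 1 ≡ n
  weight-q = +-cancelʳ-≡ q _ _ (trans (rearrange (weight q) q) (weight-B ≤-refl q<n))
    where
    rearrange : ∀ w q → (w + 1) + q ≡ w + suc q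
    rearrange = solve-∀

  edge-0q : Adj 0 q ≡ true
  edge-0q rewrite dec-false (0 ≟ℕ q) (<⇒≢ 1≤q) | weight-A 1≤q =
    dec-true (n ≤? 1 + weight q) (≤-reflexive (trans (sym weight-q) (+-comm (weight q) 1)))

  -- an isolated vertex v and v_1 are exchanged by the move v_1 v_{q+1} → v v_{q+1}
  isolated-step : ∀ m → n ≤ m → IndexShift 0 m q
  isolated-step m n≤m = record
    { a≢b            = <⇒≢ (≤-trans (s≤s z≤n) (≤-trans 2≤n n≤m))
    ; c≢a            = ≢-sym (<⇒≢ 1≤q)
    ; c≢b            = <⇒≢ (≤-trans q<n n≤m)
    ; c<n            = q<n
    ; one-above      = trans (weight-A 1≤q) (cong suc (sym (weight-isolated n≤m)))
    ; partner        = trans (cong (weight q +_) (weight-A 1≤q)) weight-q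
    ; unique-partner = unique
    }
    where
    unique : ∀ b → b ≢ 0 → b ≢ m → b ≢ q → weight b + weight 0 ≢ n
    unique b b≢0 _ b≢q e with part b
    ... | in-A b<q     = b≢0 (n≤0⇒n≡0 (≤-pred (≤-trans b<q q≤1)))
      where
      -- 2q ≤ n = (b + 1) + 1 ≤ q + 1 forces q = 1
      q≤1 : q ≤ 1
      q≤1 = +-cancelˡ-≤ q q 1 (≤-trans 2q≤n (≤-trans (≤-reflexive (trans (sym e) (cong₂ _+_ (weight-A b<q) (weight-A 1≤q))))
                                                    (+-monoˡ-≤ 1 b<q)))
    ... | in-B q≤b b<n = b≢q (suc-injective (+-cancelˡ-≡ (weight b) _ _
            (trans (weight-B q≤b b<n) (trans (cong (_+ q) (sym e′)) (rearrange (weight b) q)))))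
      where
      e′ : weight b + 1 ≡ n
      e′ = trans (cong (weight b +_) (sym (weight-A 1≤q))) e
      rearrange : ∀ w q → (w + 1) + q ≡ w + suc q
      rearrange = solve-∀
    ... | isolated n≤b = <⇒≱ 2≤n (≤-reflexive (trans (sym e) (cong₂ _+_ (weight-isolated n≤b) (weight-A 1≤q))))

  -- the last vertex of A and the last vertex of B both weigh q
  lastA lastB : ℕ
  lastA = q ∸ 1
  lastB = n ∸ 1

  1+lastA≡q : suc lastA ≡ q
  1+lastA≡q = trans (+-comm 1 lastA) (m∸n+n≡m 1≤q)

  1+lastB≡n : suc lastB ≡ n
  1+lastB≡n = trans (+-comm 1 lastB) (m∸n+n≡m (≤-trans 1≤q (<⇒≤ q<n)))

  lastA<q : lastA < q
  lastA<q = ≤-reflexive 1+lastA≡q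

  lastB<n : lastB < n
  lastB<n = ≤-reflexive 1+lastB≡n

  q≤lastB : q ≤ lastB
  q≤lastB = ≤-pred (≤-trans q<n (≤-reflexive (sym 1+lastB≡n)))

  last-weights : weight lastA ≡ weight lastB
  last-weights = trans (trans (weight-A lastA<q) 1+lastA≡q) (sym weight-lastB)
    where
    weight-lastB : weight lastB ≡ q
    weight-lastB = +-cancelʳ-≡ n _ _ (trans (cong (weight lastB +_) (sym 1+lastB≡n))
                     (trans (weight-B q≤lastB lastB<n) (+-comm n q)))

  -- Any graph G equal to the weighted graph on N ≥ n vertices is a local
  -- amoeba: the moves above connect every vertex to vertex 0 by transpositions.
  module Moves {N : ℕ} (n≤N : n ≤ N) {G : Graph N} (G≐W : G ≐ Weighted N) where

    open Threshold (λ (x : Fin N) → weight (toℕ x)) n using (shift-generator; equal-weight-generator)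
    open Generated (Generator G)

    Linked : ℕ → ℕ → Set
    Linked a b = ∀ i j → toℕ i ≡ a → toℕ j ≡ b → Tr i j

    Linked-refl : ∀ a → Linked a a
    Linked-refl _ i j refl j≡i rewrite toℕ-injective {i = i} {j = j} (sym j≡i) = Tr-refl j

    Linked-sym : ∀ {a b} → Linked a b → Linked b a
    Linked-sym ab i j i≡b j≡a = Tr-sym (ab j i j≡a i≡b)

    Linked-trans : ∀ {a b c} → b < N → Linked a b → Linked b c → Linked a c
    Linked-trans b<N ab bc i k i≡a k≡c =
      Tr-trans (ab i (fromℕ< b<N) i≡a (toℕ-fromℕ< b<N)) (bc (fromℕ< b<N) k (toℕ-fromℕ< b<N) k≡c)

    <N : ∀ {m} → m < n → m < N
    <N m<n = ≤-trans m<n n≤N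

    shift-linked : ∀ {a b c} → IndexShift a b c → Linked a b
    shift-linked s i j refl refl = gen (shift-generator G≐W (vertex-shift {z = z} s′))
      where
      open IndexShift s using (c<n)
      z : Fin N
      z = fromℕ< (<N c<n)
      s′ : IndexShift (toℕ i) (toℕ j) (toℕ z)
      s′ = subst (IndexShift (toℕ i) (toℕ j)) (sym (toℕ-fromℕ< (<N c<n))) s

    equal-weight-linked : ∀ {a b} → weight a ≡ weight b → Linked a b
    equal-weight-linked wa≡wb i j refl refl =
      gen (equal-weight-generator G≐W wa≡wb (λ r≡s → <⇒≢ 1≤q (trans (sym r≡0) (trans (cong toℕ r≡s) s≡q))) edge)
      where
      r s : Fin N
      r = fromℕ< (<N (≤-trans (s≤s z≤n) q<n))
      s = fromℕ< (<N q<n)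
      r≡0 : toℕ r ≡ 0
      r≡0 = toℕ-fromℕ< (<N (≤-trans (s≤s z≤n) q<n))
      s≡q : toℕ s ≡ q
      s≡q = toℕ-fromℕ< (<N q<n)
      edge : Weighted N r s ≡ true
      edge = trans (Weighted-Adj r s) (trans (cong₂ Adj r≡0 s≡q) edge-0q)

    linked-run : ∀ {lo hi} → hi < N → (∀ m → lo ≤ m → m < hi → Linked m (suc m)) →
                 ∀ k → lo ≤ k → k ≤ hi → Linked lo k
    linked-run hi<N step zero z≤n _ = Linked-refl 0
    linked-run {lo} hi<N step (suc k) lo≤1+k k<hi with toSum (lo ≟ℕ suc k)
    ... | inj₁ refl   = Linked-refl lo
    ... | inj₂ lo≢1+k = Linked-trans (<-trans k<hi hi<N) (linked-run hi<N step k lo≤k (<⇒≤ k<hi)) (step k lo≤k k<hi)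
      where
      lo≤k : lo ≤ k
      lo≤k = ≤-pred (≤∧≢⇒< lo≤1+k lo≢1+k)

    A-linked : ∀ k → k < q → Linked 0 k
    A-linked k k<q = linked-run (<N (<-trans lastA<q q<n)) step k z≤n (≤-pred (≤-trans k<q (≤-reflexive (sym 1+lastA≡q))))
      where
      step : ∀ m → 0 ≤ m → m < lastA → Linked m (suc m)
      step m _ m<lastA = Linked-sym (shift-linked (A-step m (≤-trans (s≤s m<lastA) (≤-reflexive 1+lastA≡q))))

    B-linked : ∀ k → q ≤ k → k < n → Linked q k
    B-linked k q≤k k<n = linked-run (<N lastB<n) step k q≤k (≤-pred (≤-trans k<n (≤-reflexive (sym 1+lastB≡n))))
      where
      step : ∀ m → q ≤ m → m < lastB → Linked m (suc m)
      step m q≤m m<lastB = subst (λ v → Linked v (suc v)) (m+[n∸m]≡n q≤m)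
                             (shift-linked (B-step (m ∸ q) (subst (λ v → suc v < n) (sym (m+[n∸m]≡n q≤m)) 1+m<n)))
        where
        1+m<n : suc m < n
        1+m<n = ≤-trans (s≤s m<lastB) (≤-reflexive 1+lastB≡n)

    all-linked : ∀ k → k < N → Linked 0 k
    all-linked k k<N with part k
    ... | in-A k<q     = A-linked k k<q
    ... | in-B q≤k k<n =
      Linked-trans (<N (<-trans lastA<q q<n)) (A-linked lastA lastA<q)
        (Linked-trans (<N lastB<n) (equal-weight-linked last-weights)
          (Linked-trans (<N q<n) (Linked-sym (B-linked lastB q≤lastB lastB<n))
            (B-linked k q≤k k<n)))
    ... | isolated n≤k = shift-linked (isolated-step k n≤k)

    local-amoeba : LocalAmoeba G
    local-amoeba = all-transpositions λ i j →
      Linked-trans (<N (≤-trans (s≤s z≤n) q<n)) (Linked-sym (all-linked (toℕ i) (toℕ<n i))) (all-linked (toℕ j) (toℕ<n j))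
        i j refl refl

indicator : Bool → ℕ
indicator b = if b then 1 else 0

count-below : (ℕ → Bool) → ℕ → ℕ
count-below g zero    = 0
count-below g (suc k) = indicator (g 0) + count-below (λ m → g (suc m)) k

sum-below : (ℕ → ℕ) → ℕ → ℕ
sum-below f zero    = 0
sum-below f (suc k) = f 0 + sum-below (λ m → f (suc m)) k

count-allFin : ∀ k (g : ℕ → Bool) → count (map (λ i → g (toℕ i)) (allFin k)) ≡ count-below g k
count-allFin k g = trans (cong count (map-tabulate {n = k} (λ i → i) (λ i → g (toℕ i)))) (count-tabulate k g)
  where
  count-tabulate : ∀ k (g : ℕ → Bool) → count (tabulate {n = k} (λ i → g (toℕ i))) ≡ count-below g k
  count-tabulate zero    g = refl
  count-tabulate (suc k) g = cong (indicator (g 0) +_) (count-tabulate k (λ m → g (suc m)))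

sum-allFin : ∀ k (f : ℕ → ℕ) → sum (map (λ i → f (toℕ i)) (allFin k)) ≡ sum-below f k
sum-allFin k f = trans (cong sum (map-tabulate {n = k} (λ i → i) (λ i → f (toℕ i)))) (sum-tabulate k f)
  where
  sum-tabulate : ∀ k (f : ℕ → ℕ) → sum (tabulate {n = k} (λ i → f (toℕ i))) ≡ sum-below f k
  sum-tabulate zero    f = refl
  sum-tabulate (suc k) f = cong (f 0 +_) (sum-tabulate k (λ m → f (suc m)))

count-below-cong : ∀ k {g h : ℕ → Bool} → (∀ m → m < k → g m ≡ h m) → count-below g k ≡ count-below h k
count-below-cong zero    g≡h = refl
count-below-cong (suc k) g≡h = cong₂ _+_ (cong indicator (g≡h 0 (s≤s z≤n))) (count-below-cong k (λ m m<k → g≡h (suc m) (s≤s m<k)))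

sum-below-cong : ∀ k {f h : ℕ → ℕ} → (∀ m → m < k → f m ≡ h m) → sum-below f k ≡ sum-below h k
sum-below-cong zero    f≡h = refl
sum-below-cong (suc k) f≡h = cong₂ _+_ (f≡h 0 (s≤s z≤n)) (sum-below-cong k (λ m m<k → f≡h (suc m) (s≤s m<k)))

sum-below-split : ∀ a b (f : ℕ → ℕ) → sum-below f (a + b) ≡ sum-below f a + sum-below (λ m → f (a + m)) b
sum-below-split zero    b f = refl
sum-below-split (suc a) b f = trans (cong (f 0 +_) (sum-below-split a b (λ m → f (suc m)))) (sym (+-assoc (f 0) _ _))

count-below-false : ∀ k {g : ℕ → Bool} → (∀ m → g m ≡ false) → count-below g k ≡ 0
count-below-false zero    _     = refl
count-below-false (suc k) g≡ff rewrite g≡ff 0 = count-below-false k (λ m → g≡ff (suc m))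

count-below-pos : ∀ k (g : ℕ → Bool) m → m < k → g m ≡ true → 1 ≤ count-below g k
count-below-pos (suc k) g zero    _         g0 rewrite g0 = s≤s z≤n
count-below-pos (suc k) g (suc m) (s≤s m<k) gm =
  ≤-trans (count-below-pos k (λ j → g (suc j)) m m<k gm) (m≤n+m _ (indicator (g 0)))

count-below-∨ : ∀ k (g h : ℕ → Bool) → count-below (λ m → g m ∨ h m) k ≤ count-below g k + count-below h k
count-below-∨ zero    g h = z≤n
count-below-∨ (suc k) g h =
  ≤-trans (+-mono-≤ (indicator-∨ (g 0) (h 0)) (count-below-∨ k (λ m → g (suc m)) (λ m → h (suc m))))
          (≤-reflexive (interchange (indicator (g 0)) (indicator (h 0)) _ _))
  where
  indicator-∨ : ∀ b c → indicator (b ∨ c) ≤ indicator b + indicator c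
  indicator-∨ false c = ≤-refl
  indicator-∨ true  c = s≤s z≤n
  interchange : ∀ a b c d → (a + b) + (c + d) ≡ (a + c) + (b + d)
  interchange = solve-∀

between : ℕ → ℕ → ℕ → Bool
between lo hi m = does (lo ≤? m) ∧ does (m <? hi)

between-true : ∀ {lo hi m} → lo ≤ m → m < hi → between lo hi m ≡ true
between-true {lo} {hi} {m} lo≤m m<hi rewrite dec-true (lo ≤? m) lo≤m | dec-true (m <? hi) m<hi = refl

between-below : ∀ {lo hi m} → m < lo → between lo hi m ≡ false
between-below {lo} {hi} {m} m<lo rewrite dec-false (lo ≤? m) (<⇒≱ m<lo) = refl

between-above : ∀ {lo hi m} → hi ≤ m → between lo hi m ≡ false
between-above {lo} {hi} {m} hi≤m rewrite dec-false (m <? hi) (≤⇒≯ hi≤m) = ∧-zeroʳ (does (lo ≤? m))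

between-bounds : ∀ {lo hi m} → between lo hi m ≡ true → lo ≤ m × m < hi
between-bounds {lo} {hi} {m} e with toSum (lo ≤? m) | toSum (m <? hi)
... | inj₁ lo≤m | inj₁ m<hi = lo≤m , m<hi
... | inj₂ lo≰m | _         with () ← trans (sym e) (between-below {lo} {hi} (≰⇒> lo≰m))
... | inj₁ _    | inj₂ m≮hi with () ← trans (sym e) (between-above {lo} {hi} (≮⇒≥ m≮hi))

count-between : ∀ lo hi k → hi ≤ k → count-below (between lo hi) k ≡ hi ∸ lo
count-between lo zero k _ = trans (count-below-false k (λ m → between-above {lo} {0} {m} z≤n)) (sym (0∸n≡0 lo))
count-between zero (suc h) (suc k) (s≤s h≤k) =
  cong suc (trans (count-below-cong k (λ m _ → shift m)) (count-between zero h k h≤k))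
  where
  shift : ∀ m → between 0 (suc h) (suc m) ≡ between 0 h m
  shift m = cong₂ _∧_ (trans (dec-true (0 ≤? suc m) z≤n) (sym (dec-true (0 ≤? m) z≤n)))
                      (does-⇔ (mk⇔ ≤-pred s≤s) (suc m <? suc h) (m <? h))
count-between (suc l) (suc h) (suc k) (s≤s h≤k) =
  trans (cong (λ b → indicator b + count-below (λ m → between (suc l) (suc h) (suc m)) k)
              (between-below {suc l} {suc h} {0} (s≤s z≤n)))
        (trans (count-below-cong k (λ m _ → shift m)) (count-between l h k h≤k))
  where
  shift : ∀ m → between (suc l) (suc h) (suc m) ≡ between l h m
  shift m = cong₂ _∧_ (does-⇔ (mk⇔ ≤-pred s≤s) (suc l ≤? suc m) (l ≤? m))
                      (does-⇔ (mk⇔ ≤-pred s≤s) (suc m <? suc h) (m <? h))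

sum-below-last : ∀ k (f : ℕ → ℕ) → sum-below f (suc k) ≡ sum-below f k + f k
sum-below-last zero    f = +-comm (f 0) 0
sum-below-last (suc k) f = trans (cong (f 0 +_) (sum-below-last k (λ m → f (suc m)))) (sym (+-assoc (f 0) _ _))

triangle-up : ∀ k → sum-below suc k * 2 ≡ k * suc k
triangle-up zero    = refl
triangle-up (suc k) = begin
  sum-below suc (suc k) * 2          ≡⟨ cong (_* 2) (sum-below-last k suc) ⟩
  (sum-below suc k + suc k) * 2      ≡⟨ *-distribʳ-+ 2 (sum-below suc k) (suc k) ⟩
  sum-below suc k * 2 + suc k * 2    ≡⟨ cong (_+ suc k * 2) (triangle-up k) ⟩
  k * suc k + suc k * 2              ≡⟨ step k ⟩
  suc k * suc (suc k)                ∎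
  where
  open ≡-Reasoning
  step : ∀ k → k * suc k + suc k * 2 ≡ suc k * suc (suc k)
  step = solve-∀

triangle-down : ∀ c → sum-below (λ m → c ∸ suc m) c * 2 + c ≡ c * c
triangle-down zero    = refl
triangle-down (suc c) = begin
  (c + S) * 2 + suc c     ≡⟨ step c S ⟩
  (S * 2 + c) + (c + suc c) ≡⟨ cong (_+ (c + suc c)) (triangle-down c) ⟩
  c * c + (c + suc c)     ≡⟨ square c ⟩
  suc c * suc c           ∎
  where
  open ≡-Reasoning
  S = sum-below (λ m → c ∸ suc m) c
  step : ∀ c S → (c + S) * 2 + suc c ≡ (S * 2 + c) + (c + suc c)
  step = solve-∀
  square : ∀ c → c * c + (c + suc c) ≡ suc c * suc c
  square = solve-∀

quarter : ∀ E r → r < 4 → (r + E * 4) / 4 ≡ E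
quarter E r r<4 = trans (+-distrib-/ r (E * 4) remainders) (cong₂ _+_ (m<n⇒m/n≡0 r<4) (m*n/n≡m E 4))
  where
  remainders : r % 4 + (E * 4) % 4 < 4
  remainders = subst (_< 4) (sym (trans (cong₂ _+_ (m<n⇒m%n≡m r<4) (m*n%n≡0 E 4)) (+-identityʳ r))) r<4

subset-of : ∀ k → (ℕ → Bool) → Subset k
subset-of k g = Vec.tabulate (λ i → g (toℕ i))

∣subset-of∣ : ∀ k (g : ℕ → Bool) → ∣ subset-of k g ∣ ≡ count-below g k
∣subset-of∣ zero    g = refl
∣subset-of∣ (suc k) g with g 0
... | true  = cong suc (∣subset-of∣ k (λ m → g (suc m)))
... | false = ∣subset-of∣ k (λ m → g (suc m))

∈-subset-of : ∀ {k} {g : ℕ → Bool} {x : Fin k} → x ∈ subset-of k g → g (toℕ x) ≡ true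
∈-subset-of {g = g} {x} x∈ = trans (sym (lookup∘tabulate (λ i → g (toℕ i)) x)) ([]=⇒lookup x∈)

subset-bound : ∀ k (S : Subset k) (g : ℕ → Bool) → (∀ x → x ∈ S → g (toℕ x) ≡ true) → ∣ S ∣ ≤ count-below g k
subset-bound zero    []           g _ = z≤n
subset-bound (suc k) (true  ∷ S) g S⊆g rewrite S⊆g Fin.zero here =
  s≤s (subset-bound k S (λ m → g (suc m)) (λ x x∈S → S⊆g (Fin.suc x) (there x∈S)))
subset-bound (suc k) (false ∷ S) g S⊆g =
  ≤-trans (subset-bound k S (λ m → g (suc m)) (λ x x∈S → S⊆g (Fin.suc x) (there x∈S))) (m≤n+m _ (indicator (g 0)))

module Parameters (n q : ℕ) (n≡2q∨2q+1 : n ≡ q + q ⊎ n ≡ suc (q + q)) (1≤q : 1 ≤ q) where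

  open HalfSplit n q n≡2q∨2q+1 1≤q

  Hq : Graph n
  Hq x y = adjℕ q (toℕ x) (toℕ y)

  degree-count : ∀ x → degree Hq x ≡ count-below (adjℕ q (toℕ x)) n
  degree-count x = count-allFin n (adjℕ q (toℕ x))

  -- v_i ∈ A is adjacent to v_{q+1}; v_{q+1} to v_1; the other vertices of B to v_{q+1}
  has-neighbour : ∀ a → a < n → ∃ λ m → m < n × adjℕ q a m ≡ true
  has-neighbour a a<n with part a
  ... | in-A a<q     = q , q<n , trans (adj-AB a<q ≤-refl) (dec-true (q ≤? a + q) (m≤n+m q a))
  ... | isolated n≤a = ⊥-elim (<⇒≱ a<n n≤a)
  ... | in-B q≤a _ with toSum (a ≟ℕ q)
  ...   | inj₁ a≡q = 0 , ≤-trans (s≤s z≤n) q<n , trans (adj-BA q≤a 1≤q) (dec-true (a ≤? 0 + q) (≤-reflexive a≡q))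
  ...   | inj₂ a≢q = q , q<n , trans (adj-BB q≤a ≤-refl) (cong not (dec-false (a ≟ℕ q) a≢q))

  degree-0 : count-below (adjℕ q 0) n ≡ 1
  degree-0 = trans (count-below-cong n neighbours) (trans (count-between q (suc q) n q<n) (m+n∸n≡m 1 q))
    where
    neighbours : ∀ m → m < n → adjℕ q 0 m ≡ between q (suc q) m
    neighbours m m<n with part m
    ... | in-A m<q     = trans (adj-AA 1≤q m<q) (sym (between-below {q} {suc q} m<q))
    ... | in-B q≤m _   = trans (adj-AB 1≤q q≤m)
                           (trans (does-⇔ (mk⇔ s≤s ≤-pred) (m ≤? q) (m <? suc q)) (sym (cong (_∧ does (m <? suc q)) (dec-true (q ≤? m) q≤m))))
    ... | isolated n≤m = ⊥-elim (<⇒≱ m<n n≤m)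

  min-degree : MinDegree Hq 1
  min-degree = at-least-one , (vertex-0 , trans (degree-count vertex-0) (trans (cong (λ v → count-below (adjℕ q v) n) (toℕ-fromℕ< 0<n)) degree-0))
    where
    0<n : 0 < n
    0<n = ≤-trans (s≤s z≤n) q<n
    vertex-0 : Fin n
    vertex-0 = fromℕ< 0<n
    at-least-one : ∀ x → 1 ≤ degree Hq x
    at-least-one x with has-neighbour (toℕ x) (toℕ<n x)
    ... | m , m<n , adjacent = subst (1 ≤_) (sym (degree-count x)) (count-below-pos n _ m m<n adjacent)

  row : ℕ → ℕ
  row a = count-below (λ b → does (a <? b) ∧ adjℕ q a b) n

  edges-by-rows : edgeCount Hq ≡ sum-below row n
  edges-by-rows = trans (cong sum (map-cong (λ x → count-allFin n (λ b → does (toℕ x <? b) ∧ adjℕ q (toℕ x) b)) (allFin n)))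
                        (sum-allFin n row)

  -- v_{a+1} ∈ A precedes its neighbours v_{q+1}, …, v_{q+a+1}
  row-A : ∀ {a} → a < q → row a ≡ suc a
  row-A {a} a<q = trans (count-below-cong n later-neighbours)
                        (trans (count-between q (suc (a + q)) n (≤-trans (+-monoˡ-< q a<q) 2q≤n)) (m+n∸n≡m (suc a) q))
    where
    later-neighbours : ∀ m → m < n → (does (a <? m) ∧ adjℕ q a m) ≡ between q (suc (a + q)) m
    later-neighbours m m<n with part m
    ... | in-A m<q     = trans (cong (does (a <? m) ∧_) (adj-AA a<q m<q))
                               (trans (∧-zeroʳ (does (a <? m))) (sym (between-below {q} {suc (a + q)} m<q)))
    ... | in-B q≤m _   = trans (cong₂ _∧_ (dec-true (a <? m) (≤-trans a<q q≤m)) (adj-AB a<q q≤m))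
                               (sym (cong₂ _∧_ (dec-true (q ≤? m) q≤m) (does-⇔ (mk⇔ ≤-pred s≤s) (m <? suc (a + q)) (m ≤? a + q))))
    ... | isolated n≤m = ⊥-elim (<⇒≱ m<n n≤m)

  -- v_{a+1} ∈ B is adjacent to all later vertices
  row-B : ∀ {a} → q ≤ a → a < n → row a ≡ n ∸ suc a
  row-B {a} q≤a a<n = trans (count-below-cong n later-neighbours) (count-between (suc a) n n ≤-refl)
    where
    later-neighbours : ∀ m → m < n → (does (a <? m) ∧ adjℕ q a m) ≡ between (suc a) n m
    later-neighbours m m<n with part m
    ... | in-A m<q     = trans (cong (_∧ adjℕ q a m) (dec-false (a <? m) (≤⇒≯ (≤-trans (<⇒≤ m<q) q≤a))))
                               (sym (between-below {suc a} {n} (s≤s (≤-trans (<⇒≤ m<q) q≤a))))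
    ... | isolated n≤m = ⊥-elim (<⇒≱ m<n n≤m)
    ... | in-B q≤m _ with toSum (a <? m)
    ...   | inj₁ a<m = trans (cong₂ _∧_ (dec-true (a <? m) a<m) (trans (adj-BB q≤a q≤m) (cong not (dec-false (a ≟ℕ m) (<⇒≢ a<m)))))
                             (sym (between-true a<m m<n))
    ...   | inj₂ a≮m = trans (cong (_∧ adjℕ q a m) (dec-false (a <? m) a≮m))
                             (sym (between-below {suc a} {n} (s≤s (≮⇒≥ a≮m))))

  c : ℕ
  c = n ∸ q

  q+c≡n : q + c ≡ n
  q+c≡n = m+[n∸m]≡n (<⇒≤ q<n)

  rows-sum : sum-below row n ≡ sum-below suc q + sum-below (λ m → c ∸ suc m) c
  rows-sum = begin
    sum-below row n                                     ≡⟨ cong (sum-below row) (sym q+c≡n) ⟩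
    sum-below row (q + c)                               ≡⟨ sum-below-split q c row ⟩
    sum-below row q + sum-below (λ m → row (q + m)) c   ≡⟨ cong₂ _+_ (sum-below-cong q (λ _ m<q → row-A m<q))
                                                                     (sum-below-cong c (λ m m<c → row-B-shifted m<c)) ⟩
    sum-below suc q + sum-below (λ m → c ∸ suc m) c     ∎
    where
    open ≡-Reasoning
    row-B-shifted : ∀ {m} → m < c → row (q + m) ≡ c ∸ suc m
    row-B-shifted {m} m<c =
      trans (row-B (m≤m+n q m) (≤-trans (+-monoʳ-< q m<c) (≤-reflexive q+c≡n)))
            (trans (cong₂ _∸_ (sym q+c≡n) (sym (+-suc q m))) ([m+n]∸[m+o]≡n∸o q c (suc m)))

  twice-edges : sum-below row n * 2 + c ≡ q * suc q + c * c
  twice-edges = begin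
    sum-below row n * 2 + c     ≡⟨ cong (λ e → e * 2 + c) rows-sum ⟩
    (S₁ + S₂) * 2 + c           ≡⟨ regroup S₁ S₂ c ⟩
    S₁ * 2 + (S₂ * 2 + c)       ≡⟨ cong₂ _+_ (triangle-up q) (triangle-down c) ⟩
    q * suc q + c * c           ∎
    where
    open ≡-Reasoning
    S₁ = sum-below suc q
    S₂ = sum-below (λ m → c ∸ suc m) c
    regroup : ∀ a b c → (a + b) * 2 + c ≡ a * 2 + (b * 2 + c)
    regroup = solve-∀

  rows-sum-to : ∀ E → q * suc q + c * c ≡ E * 2 + c → sum-below row n ≡ E
  rows-sum-to E e = *-cancelʳ-≡ _ _ 2 (+-cancelʳ-≡ c _ _ (trans twice-edges e))

  edge-count : edgeCount Hq ≡ n * n / 4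
  edge-count = trans edges-by-rows (by-parity n≡2q∨2q+1)
    where
    by-parity : n ≡ q + q ⊎ n ≡ suc (q + q) → sum-below row n ≡ n * n / 4
    by-parity (inj₁ n≡2q) =
      trans (rows-sum-to (q * q) (subst (λ v → q * suc q + v * v ≡ (q * q) * 2 + v) (sym c≡q) (twice q)))
            (sym (trans (cong (λ v → v * v / 4) n≡2q) (trans (cong (_/ 4) (square q)) (quarter (q * q) 0 (s≤s z≤n)))))
      where
      c≡q : c ≡ q
      c≡q = trans (cong (_∸ q) n≡2q) (m+n∸m≡n q q)
      twice : ∀ q → q * suc q + q * q ≡ (q * q) * 2 + q
      twice = solve-∀
      square : ∀ q → (q + q) * (q + q) ≡ 0 + (q * q) * 4
      square = solve-∀
    by-parity (inj₂ n≡2q+1) =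
      trans (rows-sum-to (q * suc q) (subst (λ v → q * suc q + v * v ≡ (q * suc q) * 2 + v) (sym c≡1+q) (twice q)))
            (sym (trans (cong (λ v → v * v / 4) n≡2q+1) (trans (cong (_/ 4) (square q)) (quarter (q * suc q) 1 (s≤s (s≤s z≤n))))))
      where
      c≡1+q : c ≡ suc q
      c≡1+q = trans (cong (_∸ q) (trans n≡2q+1 (sym (+-suc q q)))) (m+n∸m≡n q (suc q))
      twice : ∀ q → q * suc q + suc q * suc q ≡ (q * suc q) * 2 + suc q
      twice = solve-∀
      square : ∀ q → suc (q + q) * suc (q + q) ≡ 1 + (q * suc q) * 4
      square = solve-∀

  -- the clique {v_q} ∪ {v_{q+1}, …, v_{2q}}, i.e. the numbers lastA, …, 2q - 1
  top-clique : Subset n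
  top-clique = subset-of n (between lastA (q + q))

  top-clique-size : ∣ top-clique ∣ ≡ q + 1
  top-clique-size = begin
    ∣ top-clique ∣                      ≡⟨ ∣subset-of∣ n (between lastA (q + q)) ⟩
    count-below (between lastA (q + q)) n ≡⟨ count-between lastA (q + q) n 2q≤n ⟩
    (q + q) ∸ lastA                    ≡⟨ cong (_∸ lastA) (trans (cong (_+ q) (sym 1+lastA≡q)) (sym (+-suc lastA q))) ⟩
    (lastA + suc q) ∸ lastA            ≡⟨ m+n∸m≡n lastA (suc q) ⟩
    suc q                              ≡⟨ +-comm 1 q ⟩
    q + 1                              ∎
    where open ≡-Reasoning

  top-clique-is-clique : IsClique Hq top-clique
  top-clique-is-clique x y x∈ y∈ x≢y = by-parts (part a) (part b)
    where
    a b : ℕ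
    a = toℕ x
    b = toℕ y
    bounds-a : lastA ≤ a × a < q + q
    bounds-a = between-bounds (∈-subset-of {g = between lastA (q + q)} x∈)
    bounds-b : lastA ≤ b × b < q + q
    bounds-b = between-bounds (∈-subset-of {g = between lastA (q + q)} y∈)
    is-lastA : ∀ {m} → lastA ≤ m → m < q → m ≡ lastA
    is-lastA lastA≤m m<q = ≤-antisym (≤-pred (≤-trans m<q (≤-reflexive (sym 1+lastA≡q)))) lastA≤m
    below-2q : ∀ {m} → m < q + q → m ≤ lastA + q
    below-2q m<2q = ≤-pred (≤-trans m<2q (≤-reflexive (cong (_+ q) (sym 1+lastA≡q))))
    by-parts : Part a → Part b → Hq x y ≡ true
    by-parts (in-A a<q) (in-A b<q) =
      ⊥-elim (x≢y (toℕ-injective (trans (is-lastA (proj₁ bounds-a) a<q) (sym (is-lastA (proj₁ bounds-b) b<q)))))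
    by-parts (in-A a<q) (in-B q≤b _) = trans (adj-AB a<q q≤b)
      (dec-true (b ≤? a + q) (subst (λ v → b ≤ v + q) (sym (is-lastA (proj₁ bounds-a) a<q)) (below-2q (proj₂ bounds-b))))
    by-parts (in-B q≤a _) (in-A b<q) = trans (adj-BA q≤a b<q)
      (dec-true (a ≤? b + q) (subst (λ v → a ≤ v + q) (sym (is-lastA (proj₁ bounds-b) b<q)) (below-2q (proj₂ bounds-a))))
    by-parts (in-B q≤a _) (in-B q≤b _) =
      trans (adj-BB q≤a q≤b) (cong not (dec-false (a ≟ℕ b) (λ a≡b → x≢y (toℕ-injective a≡b))))
    by-parts (isolated n≤a) _ = ⊥-elim (<⇒≱ (toℕ<n x) n≤a)
    by-parts _ (isolated n≤b) = ⊥-elim (<⇒≱ (toℕ<n y) n≤b)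

  -- a clique contains at most one vertex v_{a+1} of A, together with
  -- neighbours of it in B, which are among v_{q+1}, …, v_{q+a+1}; a clique
  -- inside B has at most |B| = n - q ≤ q + 1 vertices
  clique-bound : ∀ S → IsClique Hq S → ∣ S ∣ ≤ q + 1
  clique-bound S clique with any? (λ x → (x ∈? S) ×-dec (toℕ x <? q))
  ... | no no-A = ≤-trans (subset-bound n S (between q n) inside-B) (≤-trans (≤-reflexive (count-between q n n ≤-refl)) |B|≤)
    where
    inside-B : ∀ x → x ∈ S → between q n (toℕ x) ≡ true
    inside-B x x∈S = between-true (≮⇒≥ (λ x<q → no-A (x , x∈S , x<q))) (toℕ<n x)
    |B|≤ : n ∸ q ≤ q + 1
    |B|≤ = ≤-trans (∸-monoˡ-≤ q n≤2q+1)
                   (≤-reflexive (trans (cong (_∸ q) (sym (+-suc q q))) (trans (m+n∸m≡n q (suc q)) (+-comm 1 q))))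
  ... | yes (x₀ , x₀∈S , a₀<q) = begin
    ∣ S ∣                                           ≤⟨ subset-bound n S g in-g ⟩
    count-below g n                                 ≤⟨ count-below-∨ n (between a₀ (suc a₀)) (between q (suc (a₀ + q))) ⟩
    count-below (between a₀ (suc a₀)) n
      + count-below (between q (suc (a₀ + q))) n    ≡⟨ cong₂ _+_ (count-between a₀ (suc a₀) n (≤-trans (s≤s (<⇒≤ a₀<q)) q<n))
                                                                 (count-between q (suc (a₀ + q)) n (≤-trans (+-monoˡ-< q a₀<q) 2q≤n)) ⟩
    (suc a₀ ∸ a₀) + (suc a₀ + q ∸ q)                ≡⟨ cong₂ _+_ (m+n∸n≡m 1 a₀) (m+n∸n≡m (suc a₀) q) ⟩
    1 + suc a₀                                      ≤⟨ s≤s a₀<q ⟩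
    1 + q                                           ≡⟨ +-comm 1 q ⟩
    q + 1                                           ∎
    where
    open ≤-Reasoning
    a₀ = toℕ x₀
    g : ℕ → Bool
    g m = between a₀ (suc a₀) m ∨ between q (suc (a₀ + q)) m
    in-g : ∀ x → x ∈ S → g (toℕ x) ≡ true
    in-g x x∈S with x ≟ x₀
    ... | yes refl rewrite between-true {a₀} {suc a₀} {a₀} ≤-refl ≤-refl = refl
    ... | no x≢x₀ = by-part (part (toℕ x))
      where
      adjacent : adjℕ q a₀ (toℕ x) ≡ true
      adjacent = clique x₀ x x₀∈S x∈S (≢-sym x≢x₀)
      by-part : Part (toℕ x) → g (toℕ x) ≡ true
      by-part (in-A x<q) with () ← trans (sym (adj-AA a₀<q x<q)) adjacent
      by-part (in-B q≤x _) rewrite between-true {q} {suc (a₀ + q)} q≤x (s≤s (from-does (toℕ x ≤? a₀ + q) (trans (sym (adj-AB a₀<q q≤x)) adjacent))) =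
        ∨-zeroʳ (between a₀ (suc a₀) (toℕ x))
      by-part (isolated n≤x) = ⊥-elim (<⇒≱ (toℕ<n x) n≤x)

halves : ∀ n → n ≡ n / 2 + n / 2 ⊎ n ≡ suc (n / 2 + n / 2)
halves n = by-remainder (n % 2) (m%n<n n 2) (m≡m%n+[m/n]*n n 2)
  where
  twice : n / 2 * 2 ≡ n / 2 + n / 2
  twice = trans (*-comm (n / 2) 2) (cong (n / 2 +_) (+-identityʳ (n / 2)))
  by-remainder : ∀ r → r < 2 → n ≡ r + n / 2 * 2 → n ≡ n / 2 + n / 2 ⊎ n ≡ suc (n / 2 + n / 2)
  by-remainder zero          _ n≡ = inj₁ (trans n≡ twice)
  by-remainder (suc zero)    _ n≡ = inj₂ (trans n≡ (cong suc twice))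
  by-remainder (suc (suc r)) (s≤s (s≤s ())) _

half-positive : ∀ {n} → 2 ≤ n → 1 ≤ n / 2
half-positive 2≤n = /-monoˡ-≤ 2 2≤n

-- H_n ∪ tK₁ is a local amoeba for every t ≥ 0 (so T = 0 witnesses the global
-- property, and t = 0 is H_n itself); the parameters come from Parameters.
proposition5p1 : ∀ (n : ℕ) → 2 ≤ n →
    GlobalAmoeba (H n) × LocalAmoeba (H n) × MinDegree (H n) 1
    × edgeCount (H n) ≡ (n * n) / 4 × CliqueNumber (H n) (n / 2 + 1)
proposition5p1 n n≥2 =
  (0 , λ t _ → Moves.local-amoeba (m≤m+n n t) (isolated-weighted t adjℕ-weighted)) ,
  Moves.local-amoeba ≤-refl adjℕ-weighted ,
  min-degree ,
  edge-count ,
  (top-clique , top-clique-is-clique , top-clique-size) , clique-bound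
  where
  open HalfSplit n (n / 2) (halves n) (half-positive n≥2)
  open Parameters n (n / 2) (halves n) (half-positive n≥2)
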